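{- Let $A$ be a commutative (not necessarily unital) $\mathbb K$-algebra and $n\ge0$. For every integer $k\ge0$, the action of $\Psi^k:=I^k$ on $QS^{(n)}(A):=\bigoplus_{p\le n}A^{\otimes p}$ is given by $$\Psi^k=\sum_{i=0}^n k^i e_i,\qquad e_i:=\frac{\log(I)^i}{i!},$$ where $\log(I):=\sum_{r\ge1}\frac{(-1)^{r+1}}{r}(I-\mathbf M_\emptyset)^r$ and all powers are taken in the product of $\widehat{\mathbf{WQSym}}$.
   Context: $\mathbb K$ is a field of characteristic zero. A packed word $u=u_1\cdots u_m$ is a word over the positive integers with letter set $\{1,\dots,k\}$, $k=\max(u)$, identified with the surjection $[m]\to[k]$. $\mathbf{WQSym}$ has basis $\mathbf M_u$ ($u$ packed; $\mathbf M_\emptyset=1$ for the empty word) with product $\mathbf M_u\mathbf M_v=\sum\mathbf M_w$ over packed words $w=u'v'$ with $\mathrm{pack}(u')=u$, $\mathrm{pack}(v')=v$ ($\mathrm{pack}$ replaces the $i$-th smallest letter by $i$). $\widehat{\mathbf{WQSym}}$ is its completion with respect to word length. It acts on the right on $QS(A)=\bigoplus_{p\ge0}A^{\otimes p}$ by $(a_1\otimes\cdots\otimes a_p)\mathbf M_u=\delta_{l(u)}^p\,b_1\otimes\cdots\otimes b_k$, $b_i=\prod_{u(j)=i}a_j$, extended to infinite sums (only finitely many terms act nontrivially on each tensor). $I:=\sum_{n\ge0}\mathbf M_{12\cdots n}$. -}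

module Defs where

open import Level using (Level; _⊔_) renaming (suc to lsuc)
open import Data.Nat as ℕ using (ℕ; zero; suc; _<ᵇ_; _∸_)
open import Data.Nat.Properties using (_≟_)
open import Data.Bool using (Bool; true; false; if_then_else_)
open import Data.List using (List; []; _∷_; _++_; length; map; filter; concatMap; foldr; deduplicate; upTo; applyUpTo; zip)
import Data.List.Properties as LP
open import Data.Product using (_×_; _,_; proj₁; proj₂)
open import Relation.Nullary using (¬_; does)
open import Relation.Nullary.Decidable using (⌊_⌋)
open import Relation.Binary using (Rel)
open import Algebra.Bundles using (CommutativeRing)
open import Algebra.Module.Bundles using (Module)

-- A field of characteristic zero.
-- Only inverses of the positive integers n+1 = 1+...+1 are needed below;
-- we nevertheless record the full field structure.

ringFromℕ : {c ℓ : Level} (R : CommutativeRing c ℓ) → ℕ → CommutativeRing.Carrier R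
ringFromℕ R zero    = CommutativeRing.0# R
ringFromℕ R (suc n) = CommutativeRing._+_ R (CommutativeRing.1# R) (ringFromℕ R n)

record CharZeroField (c ℓ : Level) : Set (lsuc (c ⊔ ℓ)) where
  field
    cring : CommutativeRing c ℓ
  open CommutativeRing cring
  field
    1≉0  : ¬ (1# ≈ 0#)
    inv  : (x : Carrier) → ¬ (x ≈ 0#) → Carrier
    inv-r : (x : Carrier) (p : ¬ (x ≈ 0#)) → (x * inv x p) ≈ 1#
    charZero : (n : ℕ) → ¬ (ringFromℕ cring (suc n) ≈ 0#)

module FieldOps {c ℓ : Level} (K : CharZeroField c ℓ) where
  open CharZeroField K public
  open CommutativeRing cring public hiding (ring)

  fromℕ : ℕ → Carrier
  fromℕ = ringFromℕ cring

  invSuc : ℕ → Carrier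
  invSuc n = inv (fromℕ (suc n)) (charZero n)

  invFact : ℕ → Carrier
  invFact zero    = 1#
  invFact (suc i) = invFact i * invSuc i

  sgn : ℕ → Carrier
  sgn zero    = 1#
  sgn (suc r) = - sgn r

  Σ< : ℕ → (ℕ → Carrier) → Carrier
  Σ< zero    f = 0#
  Σ< (suc n) f = Σ< n f + f n

record CommAlgebra {c ℓ : Level} (K : CharZeroField c ℓ) (a ℓa : Level)
       : Set (c ⊔ ℓ ⊔ lsuc (a ⊔ ℓa)) where
  open FieldOps K
  field
    module' : Module cring a ℓa
  open Module module' public
  infixl 7 _·_
  field
    _·_     : Carrierᴹ → Carrierᴹ → Carrierᴹ
    ·-cong  : ∀ {x x' y y'} → x ≈ᴹ x' → y ≈ᴹ y' → (x · y) ≈ᴹ (x' · y')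
    ·-assoc : ∀ x y z → ((x · y) · z) ≈ᴹ (x · (y · z))
    ·-comm  : ∀ x y → (x · y) ≈ᴹ (y · x)
    ·-distribʳ : ∀ x y z → ((x +ᴹ y) · z) ≈ᴹ ((x · z) +ᴹ (y · z))
    ·-scalarˡ  : ∀ (λ' : Carrier) x y → ((λ' *ₗ x) · y) ≈ᴹ (λ' *ₗ (x · y))
  -- (right distributivity / scalar compatibility follow by commutativity)

Word : Set
Word = List ℕ

-- pack: replace the i-th smallest letter by i
pack : Word → Word
pack w = map (λ x → suc (length (deduplicate _≟_ (filter (λ y → y ℕ.<? x) w)))) w

isPacked : Word → Bool
isPacked w = ⌊ LP.≡-dec _≟_ (pack w) w ⌋

wordsOver : ℕ → ℕ → List Word
wordsOver k zero    = [] ∷ []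
wordsOver k (suc m) = concatMap (λ x → map (x ∷_) (wordsOver k m)) (applyUpTo suc k)

packedWords : ℕ → List Word
packedWords m = filter (λ w → LP.≡-dec _≟_ (pack w) w) (wordsOver m m)

splits : Word → List (Word × Word)
splits []      = ([] , []) ∷ []
splits (x ∷ w) = ([] , x ∷ w) ∷ map (λ p → (x ∷ proj₁ p , proj₂ p)) (splits w)

maxL : Word → ℕ
maxL = foldr ℕ._⊔_ 0

-- The completion of WQSym over K: an element is the family of its
-- coefficients  F(u)  on the basis M_u  (u packed).  We represent it by a
-- function on all words; only values at packed words are meaningful, and
-- all series constructed below vanish off packed words.

module WQSymHat {c ℓ : Level} (K : CharZeroField c ℓ) where
  open FieldOps K

  Series : Set c
  Series = Word → Carrier

  onPacked : (Word → Carrier) → Series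
  onPacked f w = if isPacked w then f w else 0#

  sumL : List Carrier → Carrier
  sumL = foldr _+_ 0#

  M∅ : Series
  M∅ []      = 1#
  M∅ (_ ∷ _) = 0#

  I : Series
  I w = if ⌊ LP.≡-dec _≟_ w (applyUpTo suc (length w)) ⌋ then 1# else 0#

  _⊕_ : Series → Series → Series
  (F ⊕ G) w = F w + G w

  _⊖_ : Series → Series → Series
  (F ⊖ G) w = F w - G w

  scale : Carrier → Series → Series
  scale λ' F w = λ' * F w

  -- product:  M_u M_v = Σ_{w = u'v', pack u' = u, pack v' = v} M_w,
  -- so (F G)(w) = Σ_{w = u'v'} F(pack u') G(pack v')   for w packed
  _⊛_ : Series → Series → Series
  (F ⊛ G) = onPacked λ w → sumL (map (λ p → F (pack (proj₁ p)) * G (pack (proj₂ p))) (splits w))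

  _^_ : Series → ℕ → Series
  F ^ zero  = M∅
  F ^ suc k = (F ^ k) ⊛ F

  -- log(I) = Σ_{r≥1} (-1)^{r+1}/r (I - M_∅)^r.
  -- Since I - M_∅ has no constant term, (I - M_∅)^r vanishes on words of
  -- length < r, so the coefficient at w is the finite sum over 1 ≤ r ≤ |w|.
  logI : Series
  logI w = Σ< (length w) (λ j → sgn j * invSuc j * ((I ⊖ M∅) ^ suc j) w)
    -- j = r - 1 :  (-1)^{r+1} = (-1)^j,  1/r = invSuc j

  e : ℕ → Series
  e i = scale (invFact i) (logI ^ i)

  Ψ : ℕ → Series
  Ψ k = I ^ k

  ΣPowE : ℕ → ℕ → Series
  ΣPowE n k w = Σ< (suc n) (λ i → (fromℕ k ^ⁿ i) * e i w)
    where
    _^ⁿ_ : Carrier → ℕ → Carrier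
    x ^ⁿ zero  = 1#
    x ^ⁿ suc m = (x ^ⁿ m) * x

-- QS(A) = ⊕_p A^{⊗p}, built as the free K-module on finite tuples of
-- elements of A, modulo multilinearity (and the free-module relations).

module QS {c ℓ a ℓa : Level} (K : CharZeroField c ℓ) (A : CommAlgebra K a ℓa) where
  open FieldOps K
  open CommAlgebra A
  open WQSymHat K

  Tensor : Set a
  Tensor = List Carrierᴹ

  QSElt : Set (c ⊔ a)
  QSElt = List (Carrier × Tensor)

  data _≈ᵗ_ : Tensor → Tensor → Set (a ⊔ ℓa) where
    []  : [] ≈ᵗ []
    _∷_ : ∀ {x y xs ys} → x ≈ᴹ y → xs ≈ᵗ ys → (x ∷ xs) ≈ᵗ (y ∷ ys)

  infix 4 _∼_
  data _∼_ : QSElt → QSElt → Set (c ⊔ ℓ ⊔ a ⊔ ℓa) where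
    ∼-refl  : ∀ {x} → x ∼ x
    ∼-sym   : ∀ {x y} → x ∼ y → y ∼ x
    ∼-trans : ∀ {x y z} → x ∼ y → y ∼ z → x ∼ z
    ∼-++    : ∀ {x x' y y'} → x ∼ x' → y ∼ y' → (x ++ y) ∼ (x' ++ y')
    ∼-comm  : ∀ x y → (x ++ y) ∼ (y ++ x)
    ∼-coef  : ∀ {c c' t t'} → c ≈ c' → t ≈ᵗ t' → ((c , t) ∷ []) ∼ ((c' , t') ∷ [])
    ∼-zero  : ∀ t → ((0# , t) ∷ []) ∼ []
    ∼-add   : ∀ c d t → ((c , t) ∷ (d , t) ∷ []) ∼ ((c + d , t) ∷ [])
    ∼-lin+  : ∀ c (l r : Tensor) x y →
              ((c , l ++ (x +ᴹ y) ∷ r) ∷ []) ∼ ((c , l ++ x ∷ r) ∷ (c , l ++ y ∷ r) ∷ [])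
    ∼-lin*  : ∀ c (l r : Tensor) λ' x →
              ((c , l ++ (λ' *ₗ x) ∷ r) ∷ []) ∼ ((c * λ' , l ++ x ∷ r) ∷ [])

  data InQSn (n : ℕ) : QSElt → Set (c ⊔ a) where
    []  : InQSn n []
    _∷_ : ∀ {c t x} → length t ℕ.≤ n → InQSn n x → InQSn n ((c , t) ∷ x)

  prodA : List Carrierᴹ → Carrierᴹ
  prodA []       = 0ᴹ           -- never used: fibres of surjections are nonempty
  prodA (x ∷ []) = x
  prodA (x ∷ xs@(_ ∷ _)) = x · prodA xs

  fibreProd : Tensor → Word → ℕ → Carrierᴹ
  fibreProd t u i = prodA (map proj₁ (filter (λ p → proj₂ p ≟ i) (zip t u)))

  bTensor : Tensor → Word → Tensor
  bTensor t u = applyUpTo (λ j → fibreProd t u (suc j)) (maxL u)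

  -- right action:  (a₁⊗...⊗a_p) F = Σ_{u packed, l(u)=p} F(u) b₁⊗...⊗b_{max u}
  act : QSElt → Series → QSElt
  act x F = concatMap (λ ct → map (λ u → (proj₁ ct * F u , bTensor (proj₂ ct) u))
                                  (packedWords (length (proj₂ ct)))) x

-- Substituting X := I - M∅ into power series over K is multiplicative when one
-- only looks at packed words w of bounded length, because (I - M∅)^j vanishes
-- on words shorter than j.  It sends 1 + X to I and log (1 + X) to log I, so
-- Ψ^k = I^k is the image of (1 + X)^k and e_i the image of log (1 + X)^i / i!.
-- In K[[X]] the identity (1 + X)^k = exp (k log (1 + X)) holds because both
-- sides solve (1 + X) u' = k u with u(0) = 1, a recurrence with a unique solution
-- in characteristic zero; since log (1 + X)^i starts in degree i, on words of
-- length at most n only the terms i ≤ n matter.  Finally the action of a series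
-- on QS^(n)(A) only depends on its coefficients at packed words of length ≤ n.

module Submission where

open import Defs
open import Level using (Level)
open import Data.Nat as ℕ using (ℕ; zero; suc; _<_; _≤_; _<?_; _∸_; z≤n; s≤s)
import Data.Nat.Properties as ℕ
open import Data.Nat.Properties using (_≟_)
open import Data.Bool using (true)
open import Data.List using (List; []; _∷_; _++_; length; map; foldr; filter; deduplicate)
import Data.List.Properties as List
open import Data.List.Membership.Propositional using (_∈_)
import Data.List.Membership.Propositional.Properties as ∈
open import Data.List.Relation.Unary.All as All using (All; []; _∷_)
import Data.List.Relation.Unary.All.Properties as All
open import Data.List.Relation.Unary.Any using (here; there)
import Data.List.Relation.Unary.Any as Any
open import Data.Product using (_×_; _,_)
open import Data.Sum using (inj₁; inj₂)
open import Data.Empty using (⊥-elim)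
open import Function using (_∘_; _⇔_; mk⇔; Equivalence)
open import Relation.Nullary using (¬_; Dec; yes; no; ¬?)
open import Relation.Nullary.Decidable using (dec-true; isYes≗does)
open import Relation.Unary using (Pred; Decidable)
open import Relation.Binary.Definitions using (DecidableEquality; tri<; tri≈; tri>)
open import Relation.Binary.PropositionalEquality as ≡ using (_≡_)
open import Algebra.Bundles using (CommutativeRing)
import Algebra.Properties.CommutativeSemigroup as CommSemigroupProperties
open import Relation.Binary.Bundles using (Setoid)
import Relation.Binary.Reasoning.Setoid as SetoidReasoning
import Algebra.Properties.Ring as RingProperties
import Algebra.Properties.Semiring.Exp as SemiringExp
import Algebra.Solver.Ring.NaturalCoefficients.Default as NaturalCoefficientSolver

module ListFilter {a} {A : Set a} where
  open ≡ using (refl; cong; sym; subst)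
  open ≡.≡-Reasoning

  private
    variable
      p q : Level
      P Q : Pred A p

  filter-comm : (P? : Decidable P) (Q? : Decidable Q) (xs : List A) →
                filter P? (filter Q? xs) ≡ filter Q? (filter P? xs)
  filter-comm P? Q? [] = refl
  filter-comm P? Q? (x ∷ xs) with P? x | Q? x
  ... | yes px | yes qx
    rewrite List.filter-accept P? {xs = filter Q? xs} px | List.filter-accept Q? {xs = filter P? xs} qx
    = cong (x ∷_) (filter-comm P? Q? xs)
  ... | yes _  | no ¬qx rewrite List.filter-reject Q? {xs = filter P? xs} ¬qx = filter-comm P? Q? xs
  ... | no ¬px | yes _  rewrite List.filter-reject P? {xs = filter Q? xs} ¬px = filter-comm P? Q? xs
  ... | no _   | no _   = filter-comm P? Q? xs

  filter-absorbs : (P? : Decidable P) (Q? : Decidable Q) → (∀ {x} → P x → Q x) →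
                   (xs : List A) → filter P? (filter Q? xs) ≡ filter P? xs
  filter-absorbs P? Q? P⇒Q [] = refl
  filter-absorbs P? Q? P⇒Q (x ∷ xs) with P? x | Q? x
  ... | yes px | yes _ rewrite List.filter-accept P? {xs = filter Q? xs} px
    = cong (x ∷_) (filter-absorbs P? Q? P⇒Q xs)
  ... | yes px | no ¬qx = ⊥-elim (¬qx (P⇒Q px))
  ... | no ¬px | yes _ rewrite List.filter-reject P? {xs = filter Q? xs} ¬px = filter-absorbs P? Q? P⇒Q xs
  ... | no _   | no _  = filter-absorbs P? Q? P⇒Q xs

  filter-cong-local : (P? : Decidable P) (Q? : Decidable Q) (xs : List A) →
                      (∀ {x} → x ∈ xs → P x ⇔ Q x) → filter P? xs ≡ filter Q? xs
  filter-cong-local P? Q? [] P⇔Q = refl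
  filter-cong-local P? Q? (x ∷ xs) P⇔Q with P? x | Q? x
  ... | yes _  | yes _  = cong (x ∷_) (filter-cong-local P? Q? xs (P⇔Q ∘ there))
  ... | yes px | no ¬qx = ⊥-elim (¬qx (Equivalence.to (P⇔Q (here refl)) px))
  ... | no ¬px | yes qx = ⊥-elim (¬px (Equivalence.from (P⇔Q (here refl)) qx))
  ... | no _   | no _   = filter-cong-local P? Q? xs (P⇔Q ∘ there)

  filter-map : ∀ {b} {B : Set b} {P : Pred B p} (P? : Decidable P) (f : A → B) (xs : List A) →
               filter P? (map f xs) ≡ map f (filter (P? ∘ f) xs)
  filter-map P? f [] = refl
  filter-map P? f (x ∷ xs) with P? (f x)
  ... | yes _ = cong (f x ∷_) (filter-map P? f xs)
  ... | no _  = filter-map P? f xs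

  module _ (_≟_ : DecidableEquality A) where

    deduplicate-filter : (P? : Decidable P) (xs : List A) →
                         deduplicate _≟_ (filter P? xs) ≡ filter P? (deduplicate _≟_ xs)
    deduplicate-filter P? [] = refl
    deduplicate-filter {P = P} P? (x ∷ xs) with P? x
    ... | yes px = cong (x ∷_) (begin
      filter (¬? ∘ (x ≟_)) (deduplicate _≟_ (filter P? xs))  ≡⟨ cong (filter _) (deduplicate-filter P? xs) ⟩
      filter (¬? ∘ (x ≟_)) (filter P? (deduplicate _≟_ xs))  ≡⟨ filter-comm _ P? (deduplicate _≟_ xs) ⟩
      filter P? (filter (¬? ∘ (x ≟_)) (deduplicate _≟_ xs))  ∎)
    ... | no ¬px = begin
      deduplicate _≟_ (filter P? xs)                         ≡⟨ deduplicate-filter P? xs ⟩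
      filter P? (deduplicate _≟_ xs)                         ≡⟨ filter-absorbs P? (¬? ∘ (x ≟_)) (λ py x≡y → ¬px (subst P (sym x≡y) py)) (deduplicate _≟_ xs) ⟨
      filter P? (filter (¬? ∘ (x ≟_)) (deduplicate _≟_ xs))  ∎

    deduplicate-map : ∀ {b} {B : Set b} (_≟ᴮ_ : DecidableEquality B) (f : A → B) {U : List A} →
                      (∀ {x y} → x ∈ U → y ∈ U → f x ≡ f y → x ≡ y) →
                      (xs : List A) → All (_∈ U) xs →
                      deduplicate _≟ᴮ_ (map f xs) ≡ map f (deduplicate _≟_ xs)
    deduplicate-map _≟ᴮ_ f inj [] [] = refl
    deduplicate-map _≟ᴮ_ f inj (x ∷ xs) (x∈U ∷ xs⊆U) = cong (f x ∷_) (begin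
      filter (¬? ∘ (f x ≟ᴮ_)) (deduplicate _≟ᴮ_ (map f xs))  ≡⟨ cong (filter _) (deduplicate-map _≟ᴮ_ f inj xs xs⊆U) ⟩
      filter (¬? ∘ (f x ≟ᴮ_)) (map f (deduplicate _≟_ xs))   ≡⟨ filter-map (¬? ∘ (f x ≟ᴮ_)) f (deduplicate _≟_ xs) ⟩
      map f (filter (¬? ∘ (f x ≟ᴮ_) ∘ f) (deduplicate _≟_ xs)) ≡⟨ cong (map f) (filter-cong-local _ _ _ distinct⇔) ⟩
      map f (filter (¬? ∘ (x ≟_)) (deduplicate _≟_ xs))       ∎)
      where
      distinct⇔ : ∀ {y} → y ∈ deduplicate _≟_ xs → (¬ f x ≡ f y) ⇔ (¬ x ≡ y)
      distinct⇔ y∈ = mk⇔ (λ fx≢fy x≡y → fx≢fy (cong f x≡y))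
                         (λ x≢y fx≡fy → x≢y (inj x∈U (All.lookup (All.deduplicate⁺ _≟_ xs⊆U) y∈) fx≡fy))

module Packing where
  open ListFilter
  open ≡ using (refl; cong; sym; trans)
  open ≡.≡-Reasoning

  OrderEmbeddingOn : (ℕ → ℕ) → List ℕ → Set
  OrderEmbeddingOn f U = ∀ {x y} → x ∈ U → y ∈ U → f x < f y ⇔ x < y

  orderEmbedding⇒injective : ∀ {f U} → OrderEmbeddingOn f U →
                             ∀ {x y} → x ∈ U → y ∈ U → f x ≡ f y → x ≡ y
  orderEmbedding⇒injective emb {x} {y} x∈U y∈U fx≡fy with ℕ.<-cmp x y
  ... | tri< x<y _ _ = ⊥-elim (ℕ.<-irrefl fx≡fy (Equivalence.from (emb x∈U y∈U) x<y))
  ... | tri≈ _ x≡y _ = x≡y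
  ... | tri> _ _ y<x = ⊥-elim (ℕ.<-irrefl (sym fx≡fy) (Equivalence.from (emb y∈U x∈U) y<x))

  -- pack w = map (rank w) w holds definitionally.
  rank : Word → ℕ → ℕ
  rank w x = suc (length (deduplicate _≟_ (filter (_<? x) w)))

  pack-map : ∀ {f U} → OrderEmbeddingOn f U → (v : Word) → All (_∈ U) v → pack (map f v) ≡ pack v
  pack-map {f} {U} emb v v⊆U = begin
    map (rank (map f v)) (map f v)  ≡⟨ List.map-∘ v ⟨
    map (rank (map f v) ∘ f) v      ≡⟨ List.map-cong-local (All.map rank-f v⊆U) ⟩
    map (rank v) v                  ∎
    where
    rank-f : ∀ {x} → x ∈ U → rank (map f v) (f x) ≡ rank v x
    rank-f {x} x∈U = cong suc (trans (cong length (begin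
      deduplicate _≟_ (filter (_<? f x) (map f v))   ≡⟨ cong (deduplicate _≟_) (filter-map (_<? f x) f v) ⟩
      deduplicate _≟_ (map f (filter (λ y → f y <? f x) v))
        ≡⟨ cong (deduplicate _≟_ ∘ map f) (filter-cong-local _ (_<? x) v (λ y∈v → emb (All.lookup v⊆U y∈v) x∈U)) ⟩
      deduplicate _≟_ (map f (filter (_<? x) v))
        ≡⟨ deduplicate-map _≟_ _≟_ f (orderEmbedding⇒injective emb) _ (All.filter⁺ (_<? x) v⊆U) ⟩
      map f (deduplicate _≟_ (filter (_<? x) v))     ∎)) (List.length-map f (deduplicate _≟_ (filter (_<? x) v))))

  distinctBelow : Word → ℕ → Word
  distinctBelow w x = filter (_<? x) (deduplicate _≟_ w)

  rank-distinctBelow : ∀ w x → rank w x ≡ suc (length (distinctBelow w x))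
  rank-distinctBelow w x = cong (suc ∘ length) (deduplicate-filter _≟_ (_<? x) w)

  distinctBelow-nested : ∀ w {x y} → x ≤ y → filter (_<? x) (distinctBelow w y) ≡ distinctBelow w x
  distinctBelow-nested w x≤y = filter-absorbs (_<? _) (_<? _) (λ z<x → ℕ.<-≤-trans z<x x≤y) (deduplicate _≟_ w)

  rank-mono : ∀ w {x y} → x ≤ y → rank w x ≤ rank w y
  rank-mono w {x} {y} x≤y rewrite rank-distinctBelow w x | rank-distinctBelow w y | sym (distinctBelow-nested w x≤y) =
    s≤s (List.length-filter (_<? x) (distinctBelow w y))

  rank-strict : ∀ w {x y} → x ∈ w → x < y → rank w x < rank w y
  rank-strict w {x} {y} x∈w x<y rewrite rank-distinctBelow w x | rank-distinctBelow w y | sym (distinctBelow-nested w (ℕ.<⇒≤ x<y)) =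
    s≤s (List.filter-notAll (_<? x) (distinctBelow w y) (Any.map (λ { refl → ℕ.<-irrefl refl }) x∈below))
    where
    x∈below : x ∈ distinctBelow w y
    x∈below = ∈.∈-filter⁺ (_<? y) (∈.∈-deduplicate⁺ _≟_ x∈w) x<y

  rank-orderEmbedding : ∀ w → OrderEmbeddingOn (rank w) w
  rank-orderEmbedding w {x} {y} x∈w y∈w = mk⇔ reflect (rank-strict w x∈w)
    where
    reflect : rank w x < rank w y → x < y
    reflect rx<ry with x <? y
    ... | yes x<y = x<y
    ... | no x≮y  = ⊥-elim (ℕ.<⇒≱ rx<ry (rank-mono w (ℕ.≮⇒≥ x≮y)))

  pack-idempotent : ∀ w → pack (pack w) ≡ pack w
  pack-idempotent w = pack-map (rank-orderEmbedding w) w (All.tabulate (λ x∈w → x∈w))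

  isPacked-pack : ∀ w → isPacked (pack w) ≡ true
  isPacked-pack w = trans (isYes≗does pack-pack≟pack) (dec-true pack-pack≟pack (pack-idempotent w))
    where
    pack-pack≟pack : Dec (pack (pack w) ≡ pack w)
    pack-pack≟pack = List.≡-dec _≟_ (pack (pack w)) (pack w)

  length-pack : ∀ w → length (pack w) ≡ length w
  length-pack w = List.length-map (rank w) w

  Factorisation : Word → Word × Word → Set
  Factorisation w (u , v) = u ++ v ≡ w

  splits-factorisations : ∀ w → All (Factorisation w) (splits w)
  splits-factorisations []      = refl ∷ []
  splits-factorisations (x ∷ w) = refl ∷ All.map⁺ (All.map (cong (x ∷_)) (splits-factorisations w))

  splits-map : ∀ (f : ℕ → ℕ) w → splits (map f w) ≡ map (λ (u , v) → map f u , map f v) (splits w)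
  splits-map f []      = refl
  splits-map f (x ∷ w) = cong (([] , f x ∷ map f w) ∷_) (begin
    map (λ (u , v) → f x ∷ u , v) (splits (map f w))                           ≡⟨ cong (map _) (splits-map f w) ⟩
    map (λ (u , v) → f x ∷ u , v) (map (λ (u , v) → map f u , map f v) (splits w)) ≡⟨ List.map-∘ (splits w) ⟨
    map (λ (u , v) → f x ∷ map f u , map f v) (splits w)                        ≡⟨ List.map-∘ (splits w) ⟩
    map (λ (u , v) → map f u , map f v) (map (λ (u , v) → x ∷ u , v) (splits w)) ∎)

  pack-factorˡ : ∀ {w u v} → Factorisation w (u , v) → pack (map (rank w) u) ≡ pack u
  pack-factorˡ {w} {u} refl = pack-map (rank-orderEmbedding w) u (All.tabulate ∈.∈-++⁺ˡ)

  pack-factorʳ : ∀ {w u v} → Factorisation w (u , v) → pack (map (rank w) v) ≡ pack v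
  pack-factorʳ {w} {u} {v} refl = pack-map (rank-orderEmbedding w) v (All.tabulate (∈.∈-++⁺ʳ u))

module FiniteSums {c ℓ} (R : CommutativeRing c ℓ) where
  open CommutativeRing R
  open CommSemigroupProperties +-commutativeSemigroup using () renaming (interchange to +-interchange)
  open SetoidReasoning setoid

  Σ< : ℕ → (ℕ → Carrier) → Carrier
  Σ< zero    f = 0#
  Σ< (suc n) f = Σ< n f + f n

  ΣL : ∀ {a} {X : Set a} → List X → (X → Carrier) → Carrier
  ΣL xs f = foldr _+_ 0# (map f xs)

  Σ<-cong-< : ∀ n {f g : ℕ → Carrier} → (∀ i → i < n → f i ≈ g i) → Σ< n f ≈ Σ< n g
  Σ<-cong-< zero    f≈g = refl
  Σ<-cong-< (suc n) f≈g = +-cong (Σ<-cong-< n (λ i i<n → f≈g i (ℕ.m<n⇒m<1+n i<n))) (f≈g n ℕ.≤-refl)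

  Σ<-cong : ∀ n {f g : ℕ → Carrier} → (∀ i → f i ≈ g i) → Σ< n f ≈ Σ< n g
  Σ<-cong n f≈g = Σ<-cong-< n (λ i _ → f≈g i)

  Σ<-zero : ∀ n {f : ℕ → Carrier} → (∀ i → i < n → f i ≈ 0#) → Σ< n f ≈ 0#
  Σ<-zero zero    f≈0 = refl
  Σ<-zero (suc n) f≈0 = trans (+-cong (Σ<-zero n (λ i i<n → f≈0 i (ℕ.m<n⇒m<1+n i<n))) (f≈0 n ℕ.≤-refl)) (+-identityʳ 0#)

  Σ<-distrib-+ : ∀ n (f g : ℕ → Carrier) → Σ< n (λ i → f i + g i) ≈ Σ< n f + Σ< n g
  Σ<-distrib-+ zero    f g = sym (+-identityʳ 0#)
  Σ<-distrib-+ (suc n) f g = trans (+-cong (Σ<-distrib-+ n f g) refl) (+-interchange _ _ _ _)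

  *-distribˡ-Σ< : ∀ n a (f : ℕ → Carrier) → a * Σ< n f ≈ Σ< n (λ i → a * f i)
  *-distribˡ-Σ< zero    a f = zeroʳ a
  *-distribˡ-Σ< (suc n) a f = trans (distribˡ a _ _) (+-cong (*-distribˡ-Σ< n a f) refl)

  *-distribʳ-Σ< : ∀ n a (f : ℕ → Carrier) → Σ< n f * a ≈ Σ< n (λ i → f i * a)
  *-distribʳ-Σ< zero    a f = zeroˡ a
  *-distribʳ-Σ< (suc n) a f = trans (distribʳ a _ _) (+-cong (*-distribʳ-Σ< n a f) refl)

  Σ<-unconsˡ : ∀ n (f : ℕ → Carrier) → Σ< (suc n) f ≈ f 0 + Σ< n (f ∘ suc)
  Σ<-unconsˡ zero    f = trans (+-identityˡ _) (sym (+-identityʳ _))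
  Σ<-unconsˡ (suc n) f = trans (+-cong (Σ<-unconsˡ n f) refl) (+-assoc _ _ _)

  Σ<-truncate : ∀ {m n} (f : ℕ → Carrier) → m ≤ n → (∀ i → m ≤ i → i < n → f i ≈ 0#) → Σ< n f ≈ Σ< m f
  Σ<-truncate {n = zero}  f z≤n f≈0 = refl
  Σ<-truncate {m} {suc n} f m≤1+n f≈0 with ℕ.m≤n⇒m<n∨m≡n m≤1+n
  ... | inj₂ ≡.refl = refl
  ... | inj₁ m<1+n  = trans (+-cong (Σ<-truncate f (ℕ.≤-pred m<1+n) (λ i m≤i i<n → f≈0 i m≤i (ℕ.m<n⇒m<1+n i<n)))
                                    (f≈0 n (ℕ.≤-pred m<1+n) ℕ.≤-refl))
                            (+-identityʳ _)

  Σ<-comm : ∀ m n (h : ℕ → ℕ → Carrier) → Σ< m (λ i → Σ< n (h i)) ≈ Σ< n (λ j → Σ< m (λ i → h i j))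
  Σ<-comm zero    n h = sym (Σ<-zero n (λ _ _ → refl))
  Σ<-comm (suc m) n h = trans (+-cong (Σ<-comm m n h) refl) (sym (Σ<-distrib-+ n _ _))

  ΣL-cong-All : ∀ {a} {X : Set a} {f g : X → Carrier} (xs : List X) → All (λ x → f x ≈ g x) xs → ΣL xs f ≈ ΣL xs g
  ΣL-cong-All []       []             = refl
  ΣL-cong-All (x ∷ xs) (fx≈gx ∷ f≈g) = +-cong fx≈gx (ΣL-cong-All xs f≈g)

  ΣL-cong : ∀ {a} {X : Set a} {f g : X → Carrier} (xs : List X) → (∀ x → f x ≈ g x) → ΣL xs f ≈ ΣL xs g
  ΣL-cong xs f≈g = ΣL-cong-All xs (All.tabulate (λ {x} _ → f≈g x))

  ΣL-zero : ∀ {a} {X : Set a} {f : X → Carrier} (xs : List X) → All (λ x → f x ≈ 0#) xs → ΣL xs f ≈ 0#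
  ΣL-zero []       []             = refl
  ΣL-zero (x ∷ xs) (fx≈0 ∷ f≈0) = trans (+-cong fx≈0 (ΣL-zero xs f≈0)) (+-identityʳ 0#)

  ΣL-distrib-+ : ∀ {a} {X : Set a} (f g : X → Carrier) (xs : List X) → ΣL xs (λ x → f x + g x) ≈ ΣL xs f + ΣL xs g
  ΣL-distrib-+ f g []       = sym (+-identityʳ 0#)
  ΣL-distrib-+ f g (x ∷ xs) = trans (+-cong refl (ΣL-distrib-+ f g xs)) (+-interchange _ _ _ _)

  *-distribˡ-ΣL : ∀ {a} {X : Set a} (r : Carrier) (f : X → Carrier) (xs : List X) → r * ΣL xs f ≈ ΣL xs (λ x → r * f x)
  *-distribˡ-ΣL r f []       = zeroʳ r
  *-distribˡ-ΣL r f (x ∷ xs) = trans (distribˡ r _ _) (+-cong refl (*-distribˡ-ΣL r f xs))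

  *-distribʳ-ΣL : ∀ {a} {X : Set a} (r : Carrier) (f : X → Carrier) (xs : List X) → ΣL xs f * r ≈ ΣL xs (λ x → f x * r)
  *-distribʳ-ΣL r f []       = zeroˡ r
  *-distribʳ-ΣL r f (x ∷ xs) = trans (distribʳ r _ _) (+-cong refl (*-distribʳ-ΣL r f xs))

  ΣL-map : ∀ {a b} {X : Set a} {Y : Set b} (g : X → Y) (f : Y → Carrier) (xs : List X) → ΣL (map g xs) f ≈ ΣL xs (f ∘ g)
  ΣL-map g f xs = reflexive (≡.cong (foldr _+_ 0#) (≡.sym (List.map-∘ xs)))

  ΣL-Σ<-comm : ∀ {a} {X : Set a} (xs : List X) n (h : X → ℕ → Carrier) →
               ΣL xs (λ x → Σ< n (h x)) ≈ Σ< n (λ i → ΣL xs (λ x → h x i))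
  ΣL-Σ<-comm []       n h = sym (Σ<-zero n (λ _ _ → refl))
  ΣL-Σ<-comm (x ∷ xs) n h = trans (+-cong refl (ΣL-Σ<-comm xs n h)) (sym (Σ<-distrib-+ n _ _))

  -- Σ+≡ n h = Σ_{i + j = n} h i j.
  Σ+≡ : ℕ → (ℕ → ℕ → Carrier) → Carrier
  Σ+≡ zero    h = h 0 0
  Σ+≡ (suc n) h = h 0 (suc n) + Σ+≡ n (h ∘ suc)

  Σ+≡-cong : ∀ n {h h′ : ℕ → ℕ → Carrier} → (∀ i j → i ℕ.+ j ≡ n → h i j ≈ h′ i j) → Σ+≡ n h ≈ Σ+≡ n h′
  Σ+≡-cong zero    h≈h′ = h≈h′ 0 0 ≡.refl
  Σ+≡-cong (suc n) h≈h′ = +-cong (h≈h′ 0 (suc n) ≡.refl) (Σ+≡-cong n (λ i j i+j≡n → h≈h′ (suc i) j (≡.cong suc i+j≡n)))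

  Σ+≡-zero : ∀ n {h : ℕ → ℕ → Carrier} → (∀ i j → i ℕ.+ j ≡ n → h i j ≈ 0#) → Σ+≡ n h ≈ 0#
  Σ+≡-zero zero    h≈0 = h≈0 0 0 ≡.refl
  Σ+≡-zero (suc n) h≈0 = trans (+-cong (h≈0 0 (suc n) ≡.refl) (Σ+≡-zero n (λ i j e → h≈0 (suc i) j (≡.cong suc e))))
                               (+-identityʳ 0#)

  Σ+≡-distrib-+ : ∀ n (h h′ : ℕ → ℕ → Carrier) → Σ+≡ n (λ i j → h i j + h′ i j) ≈ Σ+≡ n h + Σ+≡ n h′
  Σ+≡-distrib-+ zero    h h′ = refl
  Σ+≡-distrib-+ (suc n) h h′ = trans (+-cong refl (Σ+≡-distrib-+ n _ _)) (+-interchange _ _ _ _)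

  *-distribˡ-Σ+≡ : ∀ n a (h : ℕ → ℕ → Carrier) → a * Σ+≡ n h ≈ Σ+≡ n (λ i j → a * h i j)
  *-distribˡ-Σ+≡ zero    a h = refl
  *-distribˡ-Σ+≡ (suc n) a h = trans (distribˡ a _ _) (+-cong refl (*-distribˡ-Σ+≡ n a _))

  *-distribʳ-Σ+≡ : ∀ n a (h : ℕ → ℕ → Carrier) → Σ+≡ n h * a ≈ Σ+≡ n (λ i j → h i j * a)
  *-distribʳ-Σ+≡ zero    a h = refl
  *-distribʳ-Σ+≡ (suc n) a h = trans (distribʳ a _ _) (+-cong refl (*-distribʳ-Σ+≡ n a _))

  Σ+≡-unconsʳ : ∀ n (h : ℕ → ℕ → Carrier) → Σ+≡ (suc n) h ≈ Σ+≡ n (λ i j → h i (suc j)) + h (suc n) 0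
  Σ+≡-unconsʳ zero    h = refl
  Σ+≡-unconsʳ (suc n) h = trans (+-cong refl (Σ+≡-unconsʳ n (h ∘ suc))) (sym (+-assoc _ _ _))

  Σ+≡-comm : ∀ n (h : ℕ → ℕ → Carrier) → Σ+≡ n h ≈ Σ+≡ n (λ i j → h j i)
  Σ+≡-comm zero    h = refl
  Σ+≡-comm (suc n) h = trans (+-cong refl (Σ+≡-comm n (h ∘ suc)))
                             (trans (+-comm _ _) (sym (Σ+≡-unconsʳ n (λ i j → h j i))))

  Σ<-Σ+≡ : ∀ N (h : ℕ → ℕ → Carrier) → Σ< N (λ n → Σ+≡ n h) ≈ Σ< N (λ i → Σ< (N ∸ i) (h i))
  Σ<-Σ+≡ zero    h = refl
  Σ<-Σ+≡ (suc N) h = begin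
    Σ< (suc N) (λ n → Σ+≡ n h)                                        ≈⟨ Σ<-unconsˡ N _ ⟩
    h 0 0 + Σ< N (λ n → h 0 (suc n) + Σ+≡ n (h ∘ suc))                ≈⟨ +-cong refl (Σ<-distrib-+ N _ _) ⟩
    h 0 0 + (Σ< N (h 0 ∘ suc) + Σ< N (λ n → Σ+≡ n (h ∘ suc)))          ≈⟨ +-assoc _ _ _ ⟨
    (h 0 0 + Σ< N (h 0 ∘ suc)) + Σ< N (λ n → Σ+≡ n (h ∘ suc))          ≈⟨ +-cong (Σ<-unconsˡ N (h 0)) (sym (Σ<-Σ+≡ N (h ∘ suc))) ⟨
    Σ< (suc N) (h 0) + Σ< N (λ i → Σ< (N ∸ i) (h (suc i)))             ≈⟨ Σ<-unconsˡ N _ ⟨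
    Σ< (suc N) (λ i → Σ< (suc N ∸ i) (h i))                            ∎

  Σ<²-Σ+≡ : ∀ N (h : ℕ → ℕ → Carrier) → (∀ i j → N ≤ i ℕ.+ j → h i j ≈ 0#) →
            Σ< N (λ i → Σ< N (h i)) ≈ Σ< N (λ n → Σ+≡ n h)
  Σ<²-Σ+≡ N h h≈0 = trans (Σ<-cong N (λ i → Σ<-truncate (h i) (ℕ.m∸n≤m N i) (λ j N∸i≤j _ → h≈0 i j (N≤i+j N∸i≤j))))
                           (sym (Σ<-Σ+≡ N h))
    where
    N≤i+j : ∀ {i j} → N ∸ i ≤ j → N ≤ i ℕ.+ j
    N≤i+j {i} N∸i≤j = ℕ.≤-trans (ℕ.m≤n+m∸n N i) (ℕ.+-monoʳ-≤ i N∸i≤j)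

module PowerSeries {c ℓ} (R : CommutativeRing c ℓ) where
  open CommutativeRing R
  open FiniteSums R
  open CommSemigroupProperties *-commutativeSemigroup using (x∙yz≈y∙xz)
  open NaturalCoefficientSolver commutativeSemiring using (solve; _:=_; _:+_; _:*_; con)

  fromℕ : ℕ → Carrier
  fromℕ = ringFromℕ R

  PS : Set c
  PS = ℕ → Carrier

  infix 4 _≈ₚ_
  _≈ₚ_ : PS → PS → Set ℓ
  a ≈ₚ b = ∀ n → a n ≈ b n

  setoidₚ : Setoid c ℓ
  setoidₚ = record
    { Carrier       = PS
    ; _≈_           = _≈ₚ_
    ; isEquivalence = record
      { refl  = λ n → refl
      ; sym   = λ a≈b n → sym (a≈b n)
      ; trans = λ a≈b b≈d n → trans (a≈b n) (b≈d n)
      }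
    }

  module ≈ₚ-Reasoning = SetoidReasoning setoidₚ
  open Setoid setoidₚ public using () renaming (refl to ≈ₚ-refl; sym to ≈ₚ-sym; trans to ≈ₚ-trans)

  infixl 6 _+ₚ_
  infixl 7 _*ₚ_
  infixr 7 _•ₚ_

  _+ₚ_ : PS → PS → PS
  (a +ₚ b) n = a n + b n

  _*ₚ_ : PS → PS → PS
  (a *ₚ b) n = Σ+≡ n (λ i j → a i * b j)

  _•ₚ_ : Carrier → PS → PS
  (r •ₚ a) n = r * a n

  0ₚ : PS
  0ₚ _ = 0#

  1ₚ : PS
  1ₚ zero    = 1#
  1ₚ (suc _) = 0#

  X : PS
  X zero    = 0#
  X (suc n) = 1ₚ n

  1+X : PS
  1+X = 1ₚ +ₚ X

  -- The Euler derivation X d/dX.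
  θ : PS → PS
  θ a n = fromℕ n * a n

  _^ₚ_ : PS → ℕ → PS
  a ^ₚ zero  = 1ₚ
  a ^ₚ suc i = (a ^ₚ i) *ₚ a

  Σₚ< : ℕ → (ℕ → PS) → PS
  Σₚ< N F n = Σ< N (λ i → F i n)

  +ₚ-cong : ∀ {a a′ b b′} → a ≈ₚ a′ → b ≈ₚ b′ → a +ₚ b ≈ₚ a′ +ₚ b′
  +ₚ-cong a≈a′ b≈b′ n = +-cong (a≈a′ n) (b≈b′ n)

  *ₚ-cong : ∀ {a a′ b b′} → a ≈ₚ a′ → b ≈ₚ b′ → a *ₚ b ≈ₚ a′ *ₚ b′
  *ₚ-cong a≈a′ b≈b′ n = Σ+≡-cong n (λ i j _ → *-cong (a≈a′ i) (b≈b′ j))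

  •ₚ-congˡ : ∀ r {a b} → a ≈ₚ b → r •ₚ a ≈ₚ r •ₚ b
  •ₚ-congˡ r a≈b n = *-congˡ (a≈b n)

  *ₚ-comm : ∀ a b → a *ₚ b ≈ₚ b *ₚ a
  *ₚ-comm a b n = trans (Σ+≡-comm n _) (Σ+≡-cong n (λ i j _ → *-comm (a j) (b i)))

  *ₚ-distribˡ : ∀ a b d → d *ₚ (a +ₚ b) ≈ₚ d *ₚ a +ₚ d *ₚ b
  *ₚ-distribˡ a b d n = trans (Σ+≡-cong n (λ i j _ → distribˡ (d i) (a j) (b j))) (Σ+≡-distrib-+ n _ _)

  *ₚ-distribʳ : ∀ a b d → (a +ₚ b) *ₚ d ≈ₚ a *ₚ d +ₚ b *ₚ d
  *ₚ-distribʳ a b d n = trans (Σ+≡-cong n (λ i j _ → distribʳ (d j) (a i) (b i))) (Σ+≡-distrib-+ n _ _)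

  •ₚ-*ₚˡ : ∀ r a b → (r •ₚ a) *ₚ b ≈ₚ r •ₚ (a *ₚ b)
  •ₚ-*ₚˡ r a b n = trans (Σ+≡-cong n (λ i j _ → *-assoc r (a i) (b j))) (sym (*-distribˡ-Σ+≡ n r _))

  •ₚ-*ₚʳ : ∀ r a b → a *ₚ (r •ₚ b) ≈ₚ r •ₚ (a *ₚ b)
  •ₚ-*ₚʳ r a b n = trans (Σ+≡-cong n (λ i j _ → x∙yz≈y∙xz (a i) r (b j))) (sym (*-distribˡ-Σ+≡ n r _))

  •ₚ-+ₚ-1 : ∀ r a → r •ₚ a +ₚ a ≈ₚ (1# + r) •ₚ a
  •ₚ-+ₚ-1 r a n = solve 2 (λ p q → (p :* q :+ q) := ((con 1 :+ p) :* q)) refl r (a n)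

  0ₚ-*ₚ : ∀ a → 0ₚ *ₚ a ≈ₚ 0ₚ
  0ₚ-*ₚ a n = Σ+≡-zero n (λ i j _ → zeroˡ (a j))

  *ₚ-0ₚ : ∀ a → a *ₚ 0ₚ ≈ₚ 0ₚ
  *ₚ-0ₚ a n = Σ+≡-zero n (λ i j _ → zeroʳ (a i))

  1ₚ-*ₚ : ∀ a → 1ₚ *ₚ a ≈ₚ a
  1ₚ-*ₚ a zero    = *-identityˡ (a 0)
  1ₚ-*ₚ a (suc n) = trans (+-cong (*-identityˡ _) (Σ+≡-zero n (λ i j _ → zeroˡ (a j)))) (+-identityʳ _)

  *ₚ-assoc : ∀ a b d → (a *ₚ b) *ₚ d ≈ₚ a *ₚ (b *ₚ d)
  *ₚ-assoc a b d zero    = *-assoc (a 0) (b 0) (d 0)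
  *ₚ-assoc a b d (suc n) = begin
    ((a *ₚ b) *ₚ d) (suc n)
      ≡⟨⟩
    (a 0 * b 0) * d (suc n) + ((a 0 •ₚ (b ∘ suc) +ₚ (a ∘ suc) *ₚ b) *ₚ d) n
      ≈⟨ +-cong refl (*ₚ-distribʳ _ _ d n) ⟩
    (a 0 * b 0) * d (suc n) + (((a 0 •ₚ (b ∘ suc)) *ₚ d) n + ((a ∘ suc) *ₚ b *ₚ d) n)
      ≈⟨ +-cong refl (+-cong (•ₚ-*ₚˡ (a 0) (b ∘ suc) d n) (*ₚ-assoc (a ∘ suc) b d n)) ⟩
    (a 0 * b 0) * d (suc n) + (a 0 * ((b ∘ suc) *ₚ d) n + ((a ∘ suc) *ₚ (b *ₚ d)) n)
      ≈⟨ solve 5 (λ p q r s t → ((p :* q) :* r :+ (p :* s :+ t)) := (p :* (q :* r :+ s) :+ t)) refl _ _ _ _ _ ⟩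
    a 0 * (b 0 * d (suc n) + ((b ∘ suc) *ₚ d) n) + ((a ∘ suc) *ₚ (b *ₚ d)) n
      ≡⟨⟩
    (a *ₚ (b *ₚ d)) (suc n)
      ∎
    where open SetoidReasoning setoid

  Σₚ<-*ₚ : ∀ N (F : ℕ → PS) b → Σₚ< N F *ₚ b ≈ₚ Σₚ< N (λ i → F i *ₚ b)
  Σₚ<-*ₚ zero    F b = 0ₚ-*ₚ b
  Σₚ<-*ₚ (suc N) F b = ≈ₚ-trans (*ₚ-distribʳ (Σₚ< N F) (F N) b) (+ₚ-cong (Σₚ<-*ₚ N F b) ≈ₚ-refl)

  X-*ₚ-suc : ∀ a n → (X *ₚ a) (suc n) ≈ a n
  X-*ₚ-suc a n = trans (+-cong (zeroˡ _) (1ₚ-*ₚ a n)) (+-identityˡ _)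

  1+X-*ₚ-suc : ∀ a n → (1+X *ₚ a) (suc n) ≈ a (suc n) + a n
  1+X-*ₚ-suc a n = trans (*ₚ-distribʳ 1ₚ X a (suc n)) (+-cong (1ₚ-*ₚ a (suc n)) (X-*ₚ-suc a n))

  θ-Leibniz : ∀ a b → θ (a *ₚ b) ≈ₚ θ a *ₚ b +ₚ a *ₚ θ b
  θ-Leibniz a b n = trans (fromℕ-*-Σ+≡ n (λ i j → a i * b j))
                          (+-cong (Σ+≡-cong n (λ i j _ → sym (*-assoc _ _ _)))
                                  (Σ+≡-cong n (λ i j _ → x∙yz≈y∙xz _ _ _)))
    where
    fromℕ-*-Σ+≡ : ∀ n (h : ℕ → ℕ → Carrier) →
                  fromℕ n * Σ+≡ n h ≈ Σ+≡ n (λ i j → fromℕ i * h i j) + Σ+≡ n (λ i j → fromℕ j * h i j)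
    fromℕ-*-Σ+≡ zero    h = trans (zeroˡ _) (sym (trans (+-cong (zeroˡ _) (zeroˡ _)) (+-identityˡ _)))
    fromℕ-*-Σ+≡ (suc n) h = begin
      (1# + fromℕ n) * (h 0 (suc n) + S)
        ≈⟨ solve 3 (λ m a s → ((con 1 :+ m) :* (a :+ s)) := ((con 1 :+ m) :* a :+ (s :+ m :* s))) refl _ _ _ ⟩
      (1# + fromℕ n) * h 0 (suc n) + (S + fromℕ n * S)
        ≈⟨ +-cong refl (+-cong refl (fromℕ-*-Σ+≡ n (h ∘ suc))) ⟩
      (1# + fromℕ n) * h 0 (suc n) + (S + (Sᵢ + Sⱼ))
        ≈⟨ solve 5 (λ a b s u v → (a :+ (s :+ (u :+ v))) := ((con 0 :* b :+ (s :+ u)) :+ (a :+ v))) refl _ (h 0 (suc n)) _ _ _ ⟩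
      (0# * h 0 (suc n) + (S + Sᵢ)) + ((1# + fromℕ n) * h 0 (suc n) + Sⱼ)
        ≈⟨ +-cong (+-cong refl shiftᵢ) refl ⟩
      Σ+≡ (suc n) (λ i j → fromℕ i * h i j) + Σ+≡ (suc n) (λ i j → fromℕ j * h i j)
        ∎
      where
      open SetoidReasoning setoid
      S Sᵢ Sⱼ : Carrier
      S  = Σ+≡ n (h ∘ suc)
      Sᵢ = Σ+≡ n (λ i j → fromℕ i * h (suc i) j)
      Sⱼ = Σ+≡ n (λ i j → fromℕ j * h (suc i) j)
      shiftᵢ : S + Sᵢ ≈ Σ+≡ n (λ i j → (1# + fromℕ i) * h (suc i) j)
      shiftᵢ = sym (trans (Σ+≡-cong n (λ i j _ → trans (distribʳ _ 1# _) (+-cong (*-identityˡ _) refl)))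
                          (Σ+≡-distrib-+ n _ _))

  θ-1ₚ : θ 1ₚ ≈ₚ 0ₚ
  θ-1ₚ zero    = zeroˡ _
  θ-1ₚ (suc n) = zeroʳ _

  θ-1+X : θ 1+X ≈ₚ X
  θ-1+X zero          = zeroˡ _
  θ-1+X (suc zero)    = trans (*-cong (+-identityʳ 1#) (+-identityˡ 1#)) (*-identityˡ 1#)
  θ-1+X (suc (suc n)) = trans (*-congˡ (+-identityˡ 0#)) (zeroʳ _)

  θ-^ₚ : ∀ a i → θ (a ^ₚ suc i) ≈ₚ fromℕ (suc i) •ₚ ((a ^ₚ i) *ₚ θ a)
  θ-^ₚ a zero = begin
    θ (1ₚ *ₚ a)                   ≈⟨ θ-Leibniz 1ₚ a ⟩
    θ 1ₚ *ₚ a +ₚ 1ₚ *ₚ θ a          ≈⟨ +ₚ-cong (≈ₚ-trans (*ₚ-cong θ-1ₚ ≈ₚ-refl) (0ₚ-*ₚ a)) ≈ₚ-refl ⟩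
    0ₚ +ₚ 1ₚ *ₚ θ a                 ≈⟨ (λ n → solve 1 (λ p → (con 0 :+ p) := ((con 1 :+ con 0) :* p)) refl _) ⟩
    fromℕ 1 •ₚ (1ₚ *ₚ θ a)          ∎
    where open ≈ₚ-Reasoning
  θ-^ₚ a (suc i) = begin
    θ (a ^ₚ suc i *ₚ a)                                  ≈⟨ θ-Leibniz (a ^ₚ suc i) a ⟩
    θ (a ^ₚ suc i) *ₚ a +ₚ W                             ≈⟨ +ₚ-cong (*ₚ-cong (θ-^ₚ a i) ≈ₚ-refl) ≈ₚ-refl ⟩
    (fromℕ (suc i) •ₚ ((a ^ₚ i) *ₚ θ a)) *ₚ a +ₚ W         ≈⟨ +ₚ-cong (≈ₚ-trans (•ₚ-*ₚˡ _ _ _) (•ₚ-congˡ _ reorder)) ≈ₚ-refl ⟩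
    fromℕ (suc i) •ₚ W +ₚ W                               ≈⟨ •ₚ-+ₚ-1 _ W ⟩
    fromℕ (suc (suc i)) •ₚ W                              ∎
    where
    open ≈ₚ-Reasoning
    W : PS
    W = a ^ₚ suc i *ₚ θ a
    reorder : ((a ^ₚ i) *ₚ θ a) *ₚ a ≈ₚ W
    reorder = ≈ₚ-trans (*ₚ-assoc _ _ _) (≈ₚ-trans (*ₚ-cong ≈ₚ-refl (*ₚ-comm _ _)) (≈ₚ-sym (*ₚ-assoc _ _ _)))

  ^ₚ-vanishes-below : ∀ {a} → a 0 ≈ 0# → ∀ i m → m < i → (a ^ₚ i) m ≈ 0#
  ^ₚ-vanishes-below {a} a₀≈0 (suc i) m m<1+i = Σ+≡-zero m term≈0
    where
    term≈0 : ∀ p q → p ℕ.+ q ≡ m → (a ^ₚ i) p * a q ≈ 0#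
    term≈0 p zero    _   = trans (*-congˡ a₀≈0) (zeroʳ _)
    term≈0 p (suc q) p+q≡m = trans (*-congʳ (^ₚ-vanishes-below a₀≈0 i p p<i)) (zeroˡ _)
      where
      p<i : p < i
      p<i = ℕ.≤-<-trans (ℕ.m≤m+n p q) (≡.subst (ℕ._≤ i) (≡.trans (≡.sym p+q≡m) (ℕ.+-suc p q)) (ℕ.≤-pred m<1+i))

  BinomialRecurrence : Carrier → PS → Set ℓ
  BinomialRecurrence x u = ∀ m → fromℕ (suc m) * u (suc m) + fromℕ m * u m ≈ x * u m

  ODE-coefficients : ∀ {x u v} → 1+X *ₚ θ u ≈ₚ x •ₚ (X *ₚ v) →
                     ∀ m → fromℕ (suc m) * u (suc m) + fromℕ m * u m ≈ x * v m
  ODE-coefficients {x} {u} {v} ode m =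
    trans (sym (1+X-*ₚ-suc (θ u) m)) (trans (ode (suc m)) (*-congˡ (X-*ₚ-suc v m)))

  binomial-ODE : ∀ k → 1+X *ₚ θ (1+X ^ₚ k) ≈ₚ fromℕ k •ₚ (X *ₚ (1+X ^ₚ k))
  binomial-ODE zero    = ≈ₚ-trans (*ₚ-cong ≈ₚ-refl θ-1ₚ) (≈ₚ-trans (*ₚ-0ₚ 1+X) (λ n → sym (zeroˡ _)))
  binomial-ODE (suc k) = begin
    1+X *ₚ θ (B *ₚ 1+X)                                  ≈⟨ *ₚ-cong ≈ₚ-refl (≈ₚ-trans (θ-Leibniz B 1+X) (+ₚ-cong ≈ₚ-refl (*ₚ-cong ≈ₚ-refl θ-1+X))) ⟩
    1+X *ₚ (θ B *ₚ 1+X +ₚ B *ₚ X)                          ≈⟨ *ₚ-distribˡ _ _ 1+X ⟩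
    1+X *ₚ (θ B *ₚ 1+X) +ₚ 1+X *ₚ (B *ₚ X)                  ≈⟨ +ₚ-cong (≈ₚ-sym (*ₚ-assoc 1+X (θ B) 1+X)) (≈ₚ-sym (*ₚ-assoc 1+X B X)) ⟩
    (1+X *ₚ θ B) *ₚ 1+X +ₚ (1+X *ₚ B) *ₚ X                  ≈⟨ +ₚ-cong (*ₚ-cong (binomial-ODE k) ≈ₚ-refl) (*ₚ-cong (*ₚ-comm 1+X B) ≈ₚ-refl) ⟩
    (fromℕ k •ₚ (X *ₚ B)) *ₚ 1+X +ₚ (B *ₚ 1+X) *ₚ X          ≈⟨ +ₚ-cong (≈ₚ-trans (•ₚ-*ₚˡ _ _ _) (•ₚ-congˡ _ (*ₚ-assoc X B 1+X))) (*ₚ-comm _ X) ⟩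
    fromℕ k •ₚ (X *ₚ (B *ₚ 1+X)) +ₚ X *ₚ (B *ₚ 1+X)          ≈⟨ •ₚ-+ₚ-1 (fromℕ k) _ ⟩
    fromℕ (suc k) •ₚ (X *ₚ (B *ₚ 1+X))                      ∎
    where
    open ≈ₚ-Reasoning
    B : PS
    B = 1+X ^ₚ k

  binomial-constant : ∀ k → (1+X ^ₚ k) 0 ≈ 1#
  binomial-constant zero    = refl
  binomial-constant (suc k) = trans (*-cong (binomial-constant k) (+-identityʳ 1#)) (*-identityˡ 1#)

module LogarithmicSeries {c ℓ} (K : CharZeroField c ℓ) where
  open FieldOps K hiding (Σ<; fromℕ)
  open FiniteSums cring
  open PowerSeries cring
  open SemiringExp semiring using (_^_)
  open NaturalCoefficientSolver commutativeSemiring using (solve; _:=_; _:*_)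
  open CommSemigroupProperties *-commutativeSemigroup using (x∙yz≈y∙xz)
  open RingProperties (CommutativeRing.ring cring) using (+-cancelʳ)

  fromℕ-suc-*-invSuc : ∀ m → fromℕ (suc m) * invSuc m ≈ 1#
  fromℕ-suc-*-invSuc m = inv-r (fromℕ (suc m)) (charZero m)

  invSuc-*-fromℕ-suc-* : ∀ m a → invSuc m * (fromℕ (suc m) * a) ≈ a
  invSuc-*-fromℕ-suc-* m a = begin
    invSuc m * (fromℕ (suc m) * a)   ≈⟨ x∙yz≈y∙xz _ _ _ ⟩
    fromℕ (suc m) * (invSuc m * a)   ≈⟨ *-assoc _ _ _ ⟨
    (fromℕ (suc m) * invSuc m) * a   ≈⟨ *-congʳ (fromℕ-suc-*-invSuc m) ⟩
    1# * a                          ≈⟨ *-identityˡ a ⟩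
    a                               ∎
    where open SetoidReasoning setoid

  *-cancelˡ-fromℕ-suc : ∀ m {a b} → fromℕ (suc m) * a ≈ fromℕ (suc m) * b → a ≈ b
  *-cancelˡ-fromℕ-suc m {a} {b} eq =
    trans (sym (invSuc-*-fromℕ-suc-* m a)) (trans (*-congˡ eq) (invSuc-*-fromℕ-suc-* m b))

  binomialRecurrence-unique : ∀ {x u v} → u 0 ≈ v 0 → BinomialRecurrence x u → BinomialRecurrence x v → u ≈ₚ v
  binomialRecurrence-unique u₀≈v₀ rec-u rec-v zero    = u₀≈v₀
  binomialRecurrence-unique {x} {u} {v} u₀≈v₀ rec-u rec-v (suc m) =
    *-cancelˡ-fromℕ-suc m (+-cancelʳ (fromℕ m * u m) _ _ (begin
      fromℕ (suc m) * u (suc m) + fromℕ m * u m   ≈⟨ rec-u m ⟩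
      x * u m                                    ≈⟨ *-congˡ uₘ≈vₘ ⟩
      x * v m                                    ≈⟨ rec-v m ⟨
      fromℕ (suc m) * v (suc m) + fromℕ m * v m   ≈⟨ +-congˡ (*-congˡ uₘ≈vₘ) ⟨
      fromℕ (suc m) * v (suc m) + fromℕ m * u m   ∎))
    where
    open SetoidReasoning setoid
    uₘ≈vₘ : u m ≈ v m
    uₘ≈vₘ = binomialRecurrence-unique u₀≈v₀ rec-u rec-v m

  -- log (1 + X) = Σ_{r ≥ 1} (-1)^{r+1} X^r / r, indexed by j = r - 1.
  L : PS
  L zero    = 0#
  L (suc j) = sgn j * invSuc j

  θL-suc : ∀ j → θ L (suc j) ≈ sgn j
  θL-suc j = trans (x∙yz≈y∙xz _ _ _) (trans (*-congˡ (fromℕ-suc-*-invSuc j)) (*-identityʳ _))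

  1+X-*ₚ-θL : 1+X *ₚ θ L ≈ₚ X
  1+X-*ₚ-θL zero          = trans (*-congˡ (zeroˡ _)) (zeroʳ _)
  1+X-*ₚ-θL (suc zero)    = trans (1+X-*ₚ-suc (θ L) 0) (trans (+-cong (θL-suc 0) (zeroˡ _)) (+-identityʳ _))
  1+X-*ₚ-θL (suc (suc m)) = trans (1+X-*ₚ-suc (θ L) (suc m)) (trans (+-cong (θL-suc (suc m)) (θL-suc m)) (-‿inverseˡ _))

  expCoeff : Carrier → ℕ → Carrier
  expCoeff x i = x ^ i * invFact i

  expCoeff-suc : ∀ x i → expCoeff x (suc i) * fromℕ (suc i) ≈ x * expCoeff x i
  expCoeff-suc x i = begin
    (x * x ^ i) * (invFact i * invSuc i) * fromℕ (suc i)
      ≈⟨ solve 5 (λ a b c d e → (((a :* b) :* (c :* d)) :* e) := ((a :* (b :* c)) :* (e :* d))) refl x _ _ _ _ ⟩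
    (x * expCoeff x i) * (fromℕ (suc i) * invSuc i)     ≈⟨ *-congˡ (fromℕ-suc-*-invSuc i) ⟩
    (x * expCoeff x i) * 1#                             ≈⟨ *-identityʳ _ ⟩
    x * expCoeff x i                                    ∎
    where open SetoidReasoning setoid

  expCoeff-powers : ∀ {x} (g : ℕ → Carrier) → g 0 ≈ 1# → (∀ m → g (suc m) ≈ g m * x) →
                    ∀ i → expCoeff x i ≈ g i * invFact i
  expCoeff-powers {x} g g₀ gₛ i = *-congʳ (sym (g≈x^ i))
    where
    g≈x^ : ∀ i → g i ≈ x ^ i
    g≈x^ zero    = g₀
    g≈x^ (suc i) = trans (gₛ i) (trans (*-congʳ (g≈x^ i)) (*-comm _ _))

  -- Truncations of exp (x L).
  expL : Carrier → ℕ → PS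
  expL x N = Σₚ< N (λ i → expCoeff x i •ₚ L ^ₚ i)

  θ-expL : ∀ x N → θ (expL x (suc N)) ≈ₚ x •ₚ (expL x N *ₚ θ L)
  θ-expL x N n = begin
    fromℕ n * Σ< (suc N) (λ i → expCoeff x i * (L ^ₚ i) n)
      ≈⟨ trans (*-distribˡ-Σ< (suc N) _ _) (Σ<-unconsˡ N _) ⟩
    fromℕ n * (expCoeff x 0 * 1ₚ n) + Σ< N (λ i → fromℕ n * (expCoeff x (suc i) * (L ^ₚ suc i) n))
      ≈⟨ +-cong constant≈0 (Σ<-cong N term) ⟩
    0# + Σ< N (λ i → x * (expCoeff x i * ((L ^ₚ i) *ₚ θ L) n))
      ≈⟨ trans (+-identityˡ _) (sym (*-distribˡ-Σ< N x _)) ⟩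
    x * Σ< N (λ i → expCoeff x i * ((L ^ₚ i) *ₚ θ L) n)
      ≈⟨ *-congˡ (trans (Σₚ<-*ₚ N _ (θ L) n) (Σ<-cong N (λ i → •ₚ-*ₚˡ (expCoeff x i) (L ^ₚ i) (θ L) n))) ⟨
    x * (expL x N *ₚ θ L) n
      ∎
    where
    open SetoidReasoning setoid
    constant≈0 : fromℕ n * (expCoeff x 0 * 1ₚ n) ≈ 0#
    constant≈0 = trans (x∙yz≈y∙xz _ _ _) (trans (*-congˡ (θ-1ₚ n)) (zeroʳ _))
    term : ∀ i → fromℕ n * (expCoeff x (suc i) * (L ^ₚ suc i) n) ≈ x * (expCoeff x i * ((L ^ₚ i) *ₚ θ L) n)
    term i = begin
      fromℕ n * (expCoeff x (suc i) * (L ^ₚ suc i) n)                     ≈⟨ x∙yz≈y∙xz _ _ _ ⟩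
      expCoeff x (suc i) * θ (L ^ₚ suc i) n                              ≈⟨ *-congˡ (θ-^ₚ L i n) ⟩
      expCoeff x (suc i) * (fromℕ (suc i) * ((L ^ₚ i) *ₚ θ L) n)          ≈⟨ *-assoc _ _ _ ⟨
      (expCoeff x (suc i) * fromℕ (suc i)) * ((L ^ₚ i) *ₚ θ L) n          ≈⟨ *-congʳ (expCoeff-suc x i) ⟩
      (x * expCoeff x i) * ((L ^ₚ i) *ₚ θ L) n                           ≈⟨ *-assoc _ _ _ ⟩
      x * (expCoeff x i * ((L ^ₚ i) *ₚ θ L) n)                           ∎

  expL-ODE : ∀ x N → 1+X *ₚ θ (expL x (suc N)) ≈ₚ x •ₚ (X *ₚ expL x N)
  expL-ODE x N = begin
    1+X *ₚ θ (expL x (suc N))        ≈⟨ *ₚ-cong ≈ₚ-refl (θ-expL x N) ⟩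
    1+X *ₚ (x •ₚ (E *ₚ θ L))          ≈⟨ •ₚ-*ₚʳ x 1+X _ ⟩
    x •ₚ (1+X *ₚ (E *ₚ θ L))          ≈⟨ •ₚ-congˡ x (≈ₚ-sym (*ₚ-assoc _ _ _)) ⟩
    x •ₚ ((1+X *ₚ E) *ₚ θ L)          ≈⟨ •ₚ-congˡ x (*ₚ-cong (*ₚ-comm 1+X E) ≈ₚ-refl) ⟩
    x •ₚ ((E *ₚ 1+X) *ₚ θ L)          ≈⟨ •ₚ-congˡ x (*ₚ-assoc _ _ _) ⟩
    x •ₚ (E *ₚ (1+X *ₚ θ L))          ≈⟨ •ₚ-congˡ x (*ₚ-cong ≈ₚ-refl 1+X-*ₚ-θL) ⟩
    x •ₚ (E *ₚ X)                     ≈⟨ •ₚ-congˡ x (*ₚ-comm E X) ⟩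
    x •ₚ (X *ₚ E)                     ∎
    where
    open ≈ₚ-Reasoning
    E : PS
    E = expL x N

  expL-stable : ∀ x {m N} → m < N → expL x N m ≈ expL x (suc m) m
  expL-stable x m<N = Σ<-truncate _ m<N (λ i m<i _ → trans (*-congˡ (^ₚ-vanishes-below refl i _ m<i)) (zeroʳ _))

  expL-diagonal-recurrence : ∀ x → BinomialRecurrence x (λ m → expL x (suc m) m)
  expL-diagonal-recurrence x m = begin
    fromℕ (suc m) * expL x (suc (suc m)) (suc m) + fromℕ m * expL x (suc m) m
      ≈⟨ +-congˡ (*-congˡ (expL-stable x (ℕ.m<n⇒m<1+n (ℕ.n<1+n m)))) ⟨
    θ E (suc m) + θ E m                  ≈⟨ ODE-coefficients (expL-ODE x (suc m)) m ⟩
    x * expL x (suc m) m                 ∎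
    where
    open SetoidReasoning setoid
    E : PS
    E = expL x (suc (suc m))

  binomial≈expL : ∀ k {m N} → m < N → (1+X ^ₚ k) m ≈ expL (fromℕ k) N m
  binomial≈expL k {m} m<N = trans
    (binomialRecurrence-unique (trans (binomial-constant k) (sym expL-constant))
                               (ODE-coefficients (binomial-ODE k))
                               (expL-diagonal-recurrence (fromℕ k)) m)
    (sym (expL-stable (fromℕ k) m<N))
    where
    expL-constant : expL (fromℕ k) 1 0 ≈ 1#
    expL-constant = trans (+-identityˡ _) (trans (*-identityʳ _) (*-identityʳ _))

module WQSymSeries {c ℓ} (K : CharZeroField c ℓ) where
  open FieldOps K hiding (Σ<; fromℕ)
  open WQSymHat K
  open FiniteSums cring
  open PowerSeries cring
  open LogarithmicSeries K
  open Packing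
  module ≈-Reasoning = SetoidReasoning setoid

  product-at-pack : ∀ (F H : Series) w →
                    (F ⊛ H) (pack w) ≡ ΣL (splits w) (λ (u , v) → F (pack u) * H (pack v))
  product-at-pack F H w rewrite isPacked-pack w = ≡.cong (foldr _+_ 0#) (begin
    map term (splits (pack w))                                        ≡⟨ ≡.cong (map term) (splits-map (rank w) w) ⟩
    map term (map (λ (u , v) → map (rank w) u , map (rank w) v) (splits w)) ≡⟨ List.map-∘ (splits w) ⟨
    map (λ (u , v) → term (map (rank w) u , map (rank w) v)) (splits w)   ≡⟨ List.map-cong-local (All.map pack-factors (splits-factorisations w)) ⟩
    map term (splits w)                                               ∎)
    where
    open ≡.≡-Reasoning
    term : Word × Word → Carrier
    term (u , v) = F (pack u) * H (pack v)
    pack-factors : ∀ {(u , v) : Word × Word} → Factorisation w (u , v) →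
                   term (map (rank w) u , map (rank w) v) ≡ term (u , v)
    pack-factors w≡uv = ≡.cong₂ (λ u v → F u * H v) (pack-factorˡ w≡uv) (pack-factorʳ w≡uv)

  ⊛-at-pack : ∀ (F H : Series) w → (F ⊛ H) (pack w) ≈ ΣL (splits w) (λ (u , v) → F (pack u) * H (pack v))
  ⊛-at-pack F H w = reflexive (product-at-pack F H w)

  infix 4 _≈ᵂ_
  _≈ᵂ_ : Series → Series → Set ℓ
  F ≈ᵂ G = ∀ w → F (pack w) ≈ G (pack w)

  ⊛-cong : ∀ {F F′ H H′} → F ≈ᵂ F′ → H ≈ᵂ H′ → F ⊛ H ≈ᵂ F′ ⊛ H′
  ⊛-cong {F} {F′} {H} {H′} F≈F′ H≈H′ w =
    trans (⊛-at-pack F H w) (trans (ΣL-cong (splits w) (λ (u , v) → *-cong (F≈F′ u) (H≈H′ v))) (sym (⊛-at-pack F′ H′ w)))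

  ΣL-splits-M∅ˡ : ∀ (g : Word → Carrier) w → ΣL (splits w) (λ (u , v) → M∅ (pack u) * g v) ≈ g w
  ΣL-splits-M∅ˡ g []      = trans (+-identityʳ _) (*-identityˡ _)
  ΣL-splits-M∅ˡ g (x ∷ w) =
    trans (+-cong (*-identityˡ _) (trans (ΣL-map _ _ (splits w)) (ΣL-zero (splits w) (All.tabulate (λ _ → zeroˡ _))))) (+-identityʳ _)

  ΣL-splits-M∅ʳ : ∀ (g : Word → Carrier) w → ΣL (splits w) (λ (u , v) → g u * M∅ (pack v)) ≈ g w
  ΣL-splits-M∅ʳ g []      = trans (+-identityʳ _) (*-identityʳ _)
  ΣL-splits-M∅ʳ g (x ∷ w) =
    trans (+-cong (zeroʳ _) (trans (ΣL-map _ _ (splits w)) (ΣL-splits-M∅ʳ (g ∘ (x ∷_)) w))) (+-identityˡ _)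

  M∅-⊛ : ∀ F → M∅ ⊛ F ≈ᵂ F
  M∅-⊛ F w = trans (⊛-at-pack M∅ F w) (ΣL-splits-M∅ˡ (F ∘ pack) w)

  ⊛-M∅ : ∀ F → F ⊛ M∅ ≈ᵂ F
  ⊛-M∅ F w = trans (⊛-at-pack F M∅ w) (ΣL-splits-M∅ʳ (F ∘ pack) w)

  -- Both sides sum t over the factorisations w = u v d into three consecutive pieces.
  ΣL-splits-assoc : ∀ (t : Word → Word → Word → Carrier) w →
    ΣL (splits w) (λ (uv , d) → ΣL (splits uv) (λ (u , v) → t u v d)) ≈
    ΣL (splits w) (λ (u , vd) → ΣL (splits vd) (λ (v , d) → t u v d))
  ΣL-splits-assoc t []      = refl
  ΣL-splits-assoc t (x ∷ w) = begin
    (t [] [] (x ∷ w) + 0#) + ΣL (map cons (splits w)) (λ (uv , d) → ΣL (splits uv) (λ (u , v) → t u v d))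
      ≈⟨ +-congˡ (trans (ΣL-map cons _ (splits w)) (ΣL-cong (splits w) (λ (uv , _) → +-congˡ (ΣL-map cons _ (splits uv))))) ⟩
    (t [] [] (x ∷ w) + 0#) + ΣL (splits w) (λ (uv , d) → t [] (x ∷ uv) d + ΣL (splits uv) (λ (u , v) → t (x ∷ u) v d))
      ≈⟨ +-congˡ (trans (ΣL-distrib-+ _ _ (splits w)) (+-congˡ (ΣL-splits-assoc (t ∘ (x ∷_)) w))) ⟩
    (t [] [] (x ∷ w) + 0#) + (ΣL (splits w) (λ (uv , d) → t [] (x ∷ uv) d) + ΣL (splits w) (λ (u , vd) → ΣL (splits vd) (λ (v , d) → t (x ∷ u) v d)))
      ≈⟨ trans (+-congʳ (+-identityʳ _)) (sym (+-assoc _ _ _)) ⟩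
    (t [] [] (x ∷ w) + ΣL (splits w) (λ (uv , d) → t [] (x ∷ uv) d)) + ΣL (splits w) (λ (u , vd) → ΣL (splits vd) (λ (v , d) → t (x ∷ u) v d))
      ≈⟨ +-cong (+-congˡ (ΣL-map cons _ (splits w))) (ΣL-map cons _ (splits w)) ⟨
    (t [] [] (x ∷ w) + ΣL (map cons (splits w)) (λ (v , d) → t [] v d)) + ΣL (map cons (splits w)) (λ (u , vd) → ΣL (splits vd) (λ (v , d) → t u v d))
      ∎
    where
    open ≈-Reasoning
    cons : Word × Word → Word × Word
    cons (u , v) = x ∷ u , v

  ⊛-assoc : ∀ F G H → (F ⊛ G) ⊛ H ≈ᵂ F ⊛ (G ⊛ H)
  ⊛-assoc F G H w = begin
    ((F ⊛ G) ⊛ H) (pack w)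
      ≈⟨ ⊛-at-pack (F ⊛ G) H w ⟩
    ΣL (splits w) (λ (uv , d) → (F ⊛ G) (pack uv) * H (pack d))
      ≈⟨ ΣL-cong (splits w) (λ (uv , d) → trans (*-congʳ (⊛-at-pack F G uv)) (*-distribʳ-ΣL _ _ (splits uv))) ⟩
    ΣL (splits w) (λ (uv , d) → ΣL (splits uv) (λ (u , v) → (F (pack u) * G (pack v)) * H (pack d)))
      ≈⟨ ΣL-splits-assoc (λ u v d → (F (pack u) * G (pack v)) * H (pack d)) w ⟩
    ΣL (splits w) (λ (u , vd) → ΣL (splits vd) (λ (v , d) → (F (pack u) * G (pack v)) * H (pack d)))
      ≈⟨ ΣL-cong (splits w) (λ (u , vd) → trans (ΣL-cong (splits vd) (λ _ → *-assoc _ _ _))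
                                                (trans (sym (*-distribˡ-ΣL _ _ (splits vd))) (*-congˡ (sym (⊛-at-pack G H vd))))) ⟩
    ΣL (splits w) (λ (u , vd) → F (pack u) * (G ⊛ H) (pack vd))
      ≈⟨ ⊛-at-pack F (G ⊛ H) w ⟨
    (F ⊛ (G ⊛ H)) (pack w)
      ∎
    where open ≈-Reasoning

  I-1 : Series
  I-1 = I ⊖ M∅

  I-1-^-vanishes-below : ∀ j w → length w < j → (I-1 ^ j) (pack w) ≈ 0#
  I-1-^-vanishes-below (suc j) w |w|<1+j =
    trans (⊛-at-pack (I-1 ^ j) I-1 w) (ΣL-zero (splits w) (All.map term≈0 (splits-factorisations w)))
    where
    term≈0 : ∀ {(u , v) : Word × Word} → Factorisation w (u , v) → (I-1 ^ j) (pack u) * I-1 (pack v) ≈ 0#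
    term≈0 {u , []}    _     = trans (*-congˡ (-‿inverseʳ 1#)) (zeroʳ _)
    term≈0 {u , x ∷ v} uxv≡w = trans (*-congʳ (I-1-^-vanishes-below j u |u|<j)) (zeroˡ _)
      where
      |u|<j : length u < j
      |u|<j = ℕ.<-≤-trans (ℕ.m<m+n (length u) (s≤s z≤n))
                          (≡.subst (ℕ._≤ j) (List.length-++ u) (ℕ.≤-pred (≡.subst (λ z → length z < suc j) (≡.sym uxv≡w) |w|<1+j)))

  I-1-^-+ : ∀ i j → (I-1 ^ i) ⊛ (I-1 ^ j) ≈ᵂ I-1 ^ (i ℕ.+ j)
  I-1-^-+ i zero    w rewrite ℕ.+-identityʳ i = ⊛-M∅ (I-1 ^ i) w
  I-1-^-+ i (suc j) w rewrite ℕ.+-suc i j =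
    trans (sym (⊛-assoc (I-1 ^ i) (I-1 ^ j) I-1 w)) (⊛-cong {(I-1 ^ i) ⊛ (I-1 ^ j)} {I-1 ^ (i ℕ.+ j)} {I-1} {I-1} (I-1-^-+ i j) (λ _ → refl) w)

  -- The power series a evaluated at X = I - M∅; the sum is finite on each word
  -- because (I - M∅)^j vanishes on words shorter than j.
  infix 8 ⟦_⟧<_
  ⟦_⟧<_ : PS → ℕ → Series
  (⟦ a ⟧< N) w = Σ< N (λ j → a j * (I-1 ^ j) w)

  ⟦_⟧ : PS → Series
  ⟦ a ⟧ w = (⟦ a ⟧< suc (length w)) w

  ⟦⟧<-⟦⟧ : ∀ {N} a w → length w < N → (⟦ a ⟧< N) (pack w) ≈ ⟦ a ⟧ (pack w)
  ⟦⟧<-⟦⟧ {N} a w |w|<N = Σ<-truncate _ (≡.subst (λ m → suc m ≤ N) (≡.sym (length-pack w)) |w|<N)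
    (λ j |pack-w|<j _ → trans (*-congˡ (I-1-^-vanishes-below j w (≡.subst (_< j) (length-pack w) |pack-w|<j))) (zeroʳ _))

  ⟦⟧-*ₚ : ∀ a b → ⟦ a ⟧ ⊛ ⟦ b ⟧ ≈ᵂ ⟦ a *ₚ b ⟧
  ⟦⟧-*ₚ a b w = begin
    (⟦ a ⟧ ⊛ ⟦ b ⟧) (pack w)
      ≈⟨ ⊛-at-pack ⟦ a ⟧ ⟦ b ⟧ w ⟩
    ΣL (splits w) (λ (u , v) → ⟦ a ⟧ (pack u) * ⟦ b ⟧ (pack v))
      ≈⟨ ΣL-cong-All (splits w) (All.map truncate-factors (splits-factorisations w)) ⟩
    ΣL (splits w) (λ (u , v) → (⟦ a ⟧< N) (pack u) * (⟦ b ⟧< N) (pack v))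
      ≈⟨ ΣL-cong (splits w) (λ (u , v) → expand (pack u) (pack v)) ⟩
    ΣL (splits w) (λ (u , v) → Σ< N (λ i → Σ< N (λ j → (a i * b j) * ((I-1 ^ i) (pack u) * (I-1 ^ j) (pack v)))))
      ≈⟨ trans (ΣL-Σ<-comm (splits w) N _) (Σ<-cong N (λ i → ΣL-Σ<-comm (splits w) N _)) ⟩
    Σ< N (λ i → Σ< N (λ j → ΣL (splits w) (λ (u , v) → (a i * b j) * ((I-1 ^ i) (pack u) * (I-1 ^ j) (pack v)))))
      ≈⟨ Σ<-cong N (λ i → Σ<-cong N (λ j → trans (sym (*-distribˡ-ΣL _ _ (splits w)))
                                                  (*-congˡ (trans (sym (⊛-at-pack (I-1 ^ i) (I-1 ^ j) w)) (I-1-^-+ i j w))))) ⟩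
    Σ< N (λ i → Σ< N (λ j → (a i * b j) * (I-1 ^ (i ℕ.+ j)) (pack w)))
      ≈⟨ Σ<²-Σ+≡ N _ (λ i j N≤i+j → trans (*-congˡ (I-1-^-vanishes-below (i ℕ.+ j) w N≤i+j)) (zeroʳ _)) ⟩
    Σ< N (λ n → Σ+≡ n (λ i j → (a i * b j) * (I-1 ^ (i ℕ.+ j)) (pack w)))
      ≈⟨ Σ<-cong N (λ n → trans (Σ+≡-cong n (λ i j i+j≡n → *-congˡ (reflexive (≡.cong (λ m → (I-1 ^ m) (pack w)) i+j≡n))))
                                (sym (*-distribʳ-Σ+≡ n _ _))) ⟩
    (⟦ a *ₚ b ⟧< N) (pack w)
      ≈⟨ ⟦⟧<-⟦⟧ (a *ₚ b) w (ℕ.n<1+n _) ⟩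
    ⟦ a *ₚ b ⟧ (pack w)
      ∎
    where
    open ≈-Reasoning
    open CommSemigroupProperties *-commutativeSemigroup using (interchange)
    N : ℕ
    N = suc (length w)
    truncate-factors : ∀ {(u , v) : Word × Word} → Factorisation w (u , v) →
                       ⟦ a ⟧ (pack u) * ⟦ b ⟧ (pack v) ≈ (⟦ a ⟧< N) (pack u) * (⟦ b ⟧< N) (pack v)
    truncate-factors {u , v} uv≡w = sym (*-cong (⟦⟧<-⟦⟧ a u (ℕ.≤-trans (s≤s (ℕ.m≤m+n (length u) (length v))) |u|+|v|<N))
                                                (⟦⟧<-⟦⟧ b v (ℕ.≤-trans (s≤s (ℕ.m≤n+m (length v) (length u))) |u|+|v|<N)))
      where
      |u|+|v|<N : length u ℕ.+ length v < N
      |u|+|v|<N = s≤s (ℕ.≤-reflexive (≡.trans (≡.sym (List.length-++ u)) (≡.cong length uv≡w)))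
    expand : ∀ u v → (⟦ a ⟧< N) u * (⟦ b ⟧< N) v ≈
                     Σ< N (λ i → Σ< N (λ j → (a i * b j) * ((I-1 ^ i) u * (I-1 ^ j) v)))
    expand u v = trans (*-distribʳ-Σ< N _ _) (Σ<-cong N (λ i → trans (*-distribˡ-Σ< N _ _)
                                                                 (Σ<-cong N (λ j → interchange _ _ _ _))))

  ⟦⟧-cong-≤ : ∀ {a b} w → (∀ m → m ≤ length w → a m ≈ b m) → ⟦ a ⟧ w ≈ ⟦ b ⟧ w
  ⟦⟧-cong-≤ w a≈b = Σ<-cong-< (suc (length w)) (λ j j≤|w| → *-congʳ (a≈b j (ℕ.≤-pred j≤|w|)))

  ⟦1ₚ⟧ : ∀ w → ⟦ 1ₚ ⟧ w ≈ M∅ w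
  ⟦1ₚ⟧ w = trans (Σ<-unconsˡ (length w) _)
                 (trans (+-cong (*-identityˡ _) (Σ<-zero (length w) (λ _ _ → zeroˡ _))) (+-identityʳ _))

  ⟦⟧-^ₚ : ∀ {a F} → ⟦ a ⟧ ≈ᵂ F → ∀ k → ⟦ a ^ₚ k ⟧ ≈ᵂ F ^ k
  ⟦⟧-^ₚ ⟦a⟧≈F zero    w = ⟦1ₚ⟧ (pack w)
  ⟦⟧-^ₚ {a} {F} ⟦a⟧≈F (suc k) w =
    trans (sym (⟦⟧-*ₚ (a ^ₚ k) a w)) (⊛-cong {⟦ a ^ₚ k ⟧} {F ^ k} {⟦ a ⟧} {F} (⟦⟧-^ₚ ⟦a⟧≈F k) ⟦a⟧≈F w)

  ⟦⟧-Σₚ<-•ₚ : ∀ N (r : ℕ → Carrier) (F : ℕ → PS) w → ⟦ Σₚ< N (λ i → r i •ₚ F i) ⟧ w ≈ Σ< N (λ i → r i * ⟦ F i ⟧ w)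
  ⟦⟧-Σₚ<-•ₚ N r F w = begin
    Σ< (suc (length w)) (λ j → Σ< N (λ i → r i * F i j) * (I-1 ^ j) w)
      ≈⟨ Σ<-cong (suc (length w)) (λ j → trans (*-distribʳ-Σ< N _ _) (Σ<-cong N (λ i → *-assoc _ _ _))) ⟩
    Σ< (suc (length w)) (λ j → Σ< N (λ i → r i * (F i j * (I-1 ^ j) w)))
      ≈⟨ Σ<-comm (suc (length w)) N _ ⟩
    Σ< N (λ i → Σ< (suc (length w)) (λ j → r i * (F i j * (I-1 ^ j) w)))
      ≈⟨ Σ<-cong N (λ i → *-distribˡ-Σ< (suc (length w)) (r i) _) ⟨
    Σ< N (λ i → r i * ⟦ F i ⟧ w)
      ∎
    where open ≈-Reasoning

  ⟦1+X⟧ : ⟦ 1+X ⟧ ≈ᵂ I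
  ⟦1+X⟧ []      = trans (+-identityˡ _) (trans (*-congʳ (+-identityʳ 1#)) (*-identityˡ 1#))
  ⟦1+X⟧ (x ∷ w) = begin
    ⟦ 1+X ⟧ (pack (x ∷ w))
      ≈⟨ trans (Σ<-unconsˡ (suc n) _) (+-congˡ (Σ<-unconsˡ n _)) ⟩
    1+X 0 * M∅ (pack (x ∷ w)) + (1+X 1 * (I-1 ^ 1) (pack (x ∷ w)) + Σ< n (λ j → 1+X (2 ℕ.+ j) * (I-1 ^ (2 ℕ.+ j)) (pack (x ∷ w))))
      ≈⟨ +-cong (zeroʳ _) (+-cong (*-congʳ (+-identityˡ 1#)) (Σ<-zero n (λ _ _ → trans (*-congʳ (+-identityˡ 0#)) (zeroˡ _)))) ⟩
    0# + (1# * (I-1 ^ 1) (pack (x ∷ w)) + 0#)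
      ≈⟨ trans (+-identityˡ _) (trans (+-identityʳ _) (*-identityˡ _)) ⟩
    (M∅ ⊛ I-1) (pack (x ∷ w))
      ≈⟨ M∅-⊛ I-1 (x ∷ w) ⟩
    I (pack (x ∷ w)) - 0#
      ≈⟨ trans (+-congˡ -0#≈0#) (+-identityʳ _) ⟩
    I (pack (x ∷ w))
      ∎
    where
    open ≈-Reasoning
    open RingProperties (CommutativeRing.ring cring) using (-0#≈0#)
    n : ℕ
    n = length (map (rank (x ∷ w)) w)

  FieldOps-Σ<≡Σ< : ∀ n f → FieldOps.Σ< K n f ≡ Σ< n f
  FieldOps-Σ<≡Σ< zero    f = ≡.refl
  FieldOps-Σ<≡Σ< (suc n) f = ≡.cong (_+ f n) (FieldOps-Σ<≡Σ< n f)

  logI≈⟦L⟧ : ∀ w → logI w ≈ ⟦ L ⟧ w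
  logI≈⟦L⟧ w = trans (reflexive (FieldOps-Σ<≡Σ< (length w) _))
                     (sym (trans (Σ<-unconsˡ (length w) _) (trans (+-congʳ (zeroˡ _)) (+-identityˡ _))))

  Ψ≈⟦1+X^⟧ : ∀ k → Ψ k ≈ᵂ ⟦ 1+X ^ₚ k ⟧
  Ψ≈⟦1+X^⟧ k w = sym (⟦⟧-^ₚ ⟦1+X⟧ k w)

  logI^≈⟦L^⟧ : ∀ i → logI ^ i ≈ᵂ ⟦ L ^ₚ i ⟧
  logI^≈⟦L^⟧ i w = sym (⟦⟧-^ₚ (λ w → sym (logI≈⟦L⟧ (pack w))) i w)

  -- g is any sequence of powers of k; ΣPowE computes them with its own local power function.
  Ψ-coefficient : ∀ n k (g : ℕ → Carrier) → g 0 ≈ 1# → (∀ m → g (suc m) ≈ g m * fromℕ k) →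
                  ∀ w → length w ≤ n → Ψ k (pack w) ≈ FieldOps.Σ< K (suc n) (λ i → g i * e i (pack w))
  Ψ-coefficient n k g g₀ gₛ w |w|≤n = begin
    Ψ k (pack w)                                             ≈⟨ Ψ≈⟦1+X^⟧ k w ⟩
    ⟦ 1+X ^ₚ k ⟧ (pack w)                                     ≈⟨ ⟦⟧-cong-≤ (pack w) binomial≈exp ⟩
    ⟦ expL x (suc n) ⟧ (pack w)                               ≈⟨ ⟦⟧-Σₚ<-•ₚ (suc n) (expCoeff x) (L ^ₚ_) (pack w) ⟩
    Σ< (suc n) (λ i → expCoeff x i * ⟦ L ^ₚ i ⟧ (pack w))     ≈⟨ Σ<-cong (suc n) term ⟩
    Σ< (suc n) (λ i → g i * e i (pack w))                    ≡⟨ FieldOps-Σ<≡Σ< (suc n) _ ⟨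
    FieldOps.Σ< K (suc n) (λ i → g i * e i (pack w))          ∎
    where
    open ≈-Reasoning
    x : Carrier
    x = fromℕ k
    binomial≈exp : ∀ m → m ≤ length (pack w) → (1+X ^ₚ k) m ≈ expL x (suc n) m
    binomial≈exp m m≤|w| = binomial≈expL k (s≤s (ℕ.≤-trans m≤|w| (≡.subst (_≤ n) (≡.sym (length-pack w)) |w|≤n)))
    term : ∀ i → expCoeff x i * ⟦ L ^ₚ i ⟧ (pack w) ≈ g i * e i (pack w)
    term i = trans (*-congʳ (expCoeff-powers g g₀ gₛ i)) (trans (*-assoc _ _ _) (*-congˡ (*-congˡ (sym (logI^≈⟦L^⟧ i w)))))

  ΣPowE-coefficient : ∀ n k u → pack u ≡ u → length u ≤ n → Ψ k u ≈ ΣPowE n k u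
  ΣPowE-coefficient n k u pack-u≡u |u|≤n =
    ≡.subst (λ w → Ψ k w ≈ ΣPowE n k w) pack-u≡u (Ψ-coefficient n k _ refl (λ _ → refl) u |u|≤n)

module PackedWords where
  open ≡ using (cong)

  wordsOver-length : ∀ k m → All (λ w → length w ≡ m) (wordsOver k m)
  wordsOver-length k zero    = ≡.refl ∷ []
  wordsOver-length k (suc m) =
    All.concat⁺ (All.map⁺ (All.applyUpTo⁺₂ suc k (λ x → All.map⁺ (All.map (cong suc) (wordsOver-length k m)))))

  packedWords-packed : ∀ m → All (λ u → pack u ≡ u) (packedWords m)
  packedWords-packed m = All.all-filter (λ w → List.≡-dec _≟_ (pack w) w) (wordsOver m m)

  packedWords-length : ∀ m → All (λ u → length u ≡ m) (packedWords m)
  packedWords-length m = All.filter⁺ (λ w → List.≡-dec _≟_ (pack w) w) (wordsOver-length m m)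

module QSAction {c ℓ a ℓa} (K : CharZeroField c ℓ) (A : CommAlgebra K a ℓa) where
  open FieldOps K using (_≈_; _*_; *-congˡ)
  open WQSymHat K using (Series)
  open CommAlgebra A using (≈ᴹ-refl)
  open QS K A
  open PackedWords

  ≈ᵗ-refl : ∀ t → t ≈ᵗ t
  ≈ᵗ-refl []      = []
  ≈ᵗ-refl (_ ∷ t) = ≈ᴹ-refl ∷ ≈ᵗ-refl t

  act-cong : ∀ n (F H : Series) → (∀ u → pack u ≡ u → length u ≤ n → F u ≈ H u) →
             ∀ x → InQSn n x → act x F ∼ act x H
  act-cong n F H F≈H []              []              = ∼-refl
  act-cong n F H F≈H ((r , t) ∷ x) (|t|≤n ∷ x∈QSn) =
    ∼-++ (terms-cong (packedWords (length t)) (packedWords-packed (length t)) (packedWords-length (length t)))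
         (act-cong n F H F≈H x x∈QSn)
    where
    terms-cong : ∀ us → All (λ u → pack u ≡ u) us → All (λ u → length u ≡ length t) us →
                 map (λ u → (r * F u , bTensor t u)) us ∼ map (λ u → (r * H u , bTensor t u)) us
    terms-cong []       _                  _                 = ∼-refl
    terms-cong (u ∷ us) (pack-u≡u ∷ packed) (|u|≡|t| ∷ lengths) =
      ∼-++ {x = (r * F u , bTensor t u) ∷ []} {x' = (r * H u , bTensor t u) ∷ []}
           (∼-coef (*-congˡ (F≈H u pack-u≡u (≡.subst (_≤ n) (≡.sym |u|≡|t|) |t|≤n))) (≈ᵗ-refl _))
           (terms-cong us packed lengths)

mainTheorem7 : ∀ {c ℓ a ℓa : Level} (K : CharZeroField c ℓ) (A : CommAlgebra K a ℓa)
                 (n k : ℕ) (x : QS.QSElt K A) → QS.InQSn K A n x →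
                 QS._∼_ K A (QS.act K A x (WQSymHat.Ψ K k)) (QS.act K A x (WQSymHat.ΣPowE K n k))
mainTheorem7 K A n k =
  QSAction.act-cong K A n (WQSymHat.Ψ K k) (WQSymHat.ΣPowE K n k) (WQSymSeries.ΣPowE-coefficient K n k)
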